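{- For any positive integers $T$ and $b$ with $b\le T$, there exists an instance of the stationary-demand single-item pricing problem with $T$ periods and $b$ units of starting inventory for which the expected revenue of any policy is at most $$\frac{\mathbb{E}[\min\{\mathrm{Bin}(T,b/T),b\}]}{b}\cdot\mathsf{OPT}_{\mathrm{LP}},$$ where $\mathsf{OPT}_{\mathrm{LP}}$ is the optimal value of DLP-S.
   Context: Single-item pricing with stationary Bernoulli demand: one item with $b$ units of inventory is sold over $T$ periods; in each period the firm offers one of the prices $p_1,\dots,p_m>0$ (or makes no offer); if price $p_j$ is offered and inventory remains, a sale occurs with probability $q_j$, independently across periods, earning $p_j$. A policy may be static or dynamic. DLP-S: maximize $T\sum_{j=1}^m p_jq_jx_j$ subject to $T\sum_j q_jx_j\le b$, $\sum_j x_j\le1$, $x_j\ge0$. $\mathrm{Bin}(T,\rho)$ is a Binomial random variable with $T$ trials and success probability $\rho$.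
   Formalization: Policies choose prices with rational probabilities only, and the prices $p_j$, the purchase probabilities $q_j$ and the DLP-S variables $x_j$ are taken in ℚ. -}

module Defs where

open import Data.Nat as ℕ using (ℕ; zero; suc; _⊓_; NonZero)
open import Data.Nat.Combinatorics using (_C_)
open import Data.Fin as F using (Fin; toℕ)
open import Data.Maybe using (Maybe; just; nothing)
open import Data.Bool using (Bool; true; false)
open import Data.List using (List; []; _∷_)
open import Data.Product using (Σ; _×_; _,_)
open import Relation.Binary.PropositionalEquality using (_≡_)
open import Data.Integer using (+_)
open import Data.Rational using (ℚ; 0ℚ; 1ℚ; _+_; _*_; _-_; _≤_; _<_; _/_)

ℕ→ℚ : ℕ → ℚ
ℕ→ℚ n = (+ n) / 1

sumFin : (n : ℕ) → (Fin n → ℚ) → ℚ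
sumFin zero    f = 0ℚ
sumFin (suc n) f = f F.zero + sumFin n (λ j → f (F.suc j))

pow : ℚ → ℕ → ℚ
pow x zero    = 1ℚ
pow x (suc k) = x * pow x k

-- E[ min { Bin(T, ρ), b } ] = Σ_{k=0}^{T} C(T,k) ρ^k (1-ρ)^(T-k) min(k,b)
binomExpMin : (T : ℕ) → (ρ : ℚ) → (b : ℕ) → ℚ
binomExpMin T ρ b = sumFin (suc T) (λ k →
  ℕ→ℚ (T C toℕ k) * pow ρ (toℕ k) * pow (1ℚ - ρ) (T ℕ.∸ toℕ k) * ℕ→ℚ (toℕ k ⊓ b))

record Instance : Set where
  field
    m        : ℕ
    m-pos    : 1 ℕ.≤ m
    price    : Fin m → ℚ
    prob     : Fin m → ℚ
    price-pos : ∀ j → 0ℚ < price j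
    prob-pos  : ∀ j → 0ℚ < prob j
    prob-le1  : ∀ j → prob j ≤ 1ℚ

open Instance public

-- Actions: nothing = make no offer, just j = offer price p_j.
Action : Instance → Set
Action I = Maybe (Fin (m I))

-- A history: the list (most recent first) of past actions and whether a sale occurred.
History : Instance → Set
History I = List (Action I × Bool)

massA : (I : Instance) → (Action I → ℚ) → ℚ
massA I w = w nothing + sumFin (m I) (λ j → w (just j))

-- A (possibly randomized, history-dependent, i.e. dynamic) policy:
-- at each history it chooses an action according to a probability distribution.
record Policy (I : Instance) : Set where
  field
    act     : History I → Action I → ℚ
    act-nonneg : ∀ h a → 0ℚ ≤ act h a
    act-sum : ∀ h → massA I (act h) ≡ 1ℚ

open Policy public

revenueFrom : (I : Instance) → Policy I → (t inv : ℕ) → History I → ℚ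
revenueFrom I π zero    inv     h = 0ℚ
revenueFrom I π (suc t) zero    h = 0ℚ
revenueFrom I π (suc t) (suc k) h =
    act π h nothing * revenueFrom I π t (suc k) ((nothing , false) ∷ h)
  + sumFin (m I) (λ j → act π h (just j) *
      ( prob I j * (price I j + revenueFrom I π t k ((just j , true) ∷ h))
      + (1ℚ - prob I j) * revenueFrom I π t (suc k) ((just j , false) ∷ h)))

revenue : (I : Instance) → Policy I → (T b : ℕ) → ℚ
revenue I π T b = revenueFrom I π T b []

LPFeasible : (I : Instance) → (T b : ℕ) → (Fin (m I) → ℚ) → Set
LPFeasible I T b x =
  (∀ j → 0ℚ ≤ x j) ×
  (sumFin (m I) x ≤ 1ℚ) ×
  (ℕ→ℚ T * sumFin (m I) (λ j → prob I j * x j) ≤ ℕ→ℚ b)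

LPObjective : (I : Instance) → (T : ℕ) → (Fin (m I) → ℚ) → ℚ
LPObjective I T x = ℕ→ℚ T * sumFin (m I) (λ j → price I j * prob I j * x j)

IsOPT-LP : (I : Instance) → (T b : ℕ) → ℚ → Set
IsOPT-LP I T b v =
  Σ (Fin (m I) → ℚ) (λ x → LPFeasible I T b x × LPObjective I T x ≡ v) ×
  (∀ x → LPFeasible I T b x → LPObjective I T x ≤ v)

module Submission where

open import Defs
open import Data.Nat using (ℕ; NonZero)
open import Data.Nat as ℕ using ()
open import Data.Product using (Σ; _×_)
open import Data.Integer using (+_)
open import Data.Rational using (ℚ; _*_; _≤_; _/_)

open import Algebra.Bundles using (CommutativeRing)
open import Data.Bool using (true; false)
open import Data.Fin as Fin using (Fin; toℕ; inject₁; fromℕ)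
open import Data.Fin.Properties using (toℕ-inject₁; toℕ-fromℕ)
import Data.Integer as ℤ
import Data.Integer.Properties as ℤₚ
import Data.Integer.Solver as ℤ-Solver
open import Data.List using ([]; _∷_)
open import Data.Maybe using (just; nothing)
open import Data.Nat using (zero; suc; _∸_; _⊓_; z≤n; s≤s)
open import Data.Nat.Combinatorics using (_C_; nCk+nC[k+1]≡[n+1]C[k+1])
open import Data.Nat.Combinatorics.Specification using (k>n⇒nCk≡0)
import Data.Nat.Properties as ℕₚ
open import Data.Product using (_,_)
open import Data.Rational using (0ℚ; 1ℚ; _+_; _-_; -_; _<_; toℚᵘ; NonNegative; nonNegative)
open import Data.Rational.Properties
  using ( ≤-refl; ≤-reflexive; ≤-trans; <⇒≤; +-mono-≤; +-monoˡ-≤; +-monoʳ-≤; *-monoˡ-≤-nonNeg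
        ; +-identityʳ; +-inverseʳ; *-identityˡ; *-identityʳ; *-zeroˡ; *-zeroʳ; *-assoc
        ; *-distribˡ-+; *-distribʳ-+; +-*-commutativeRing
        ; positive⁻¹; nonNegative⁻¹; normalize-pos
        ; toℚᵘ-injective; toℚᵘ-fromℚᵘ; toℚᵘ-cancel-≤; toℚᵘ-homo-+; toℚᵘ-homo-*
        ; module ≤-Reasoning )
import Data.Rational.Solver as ℚ-Solver
open import Data.Rational.Unnormalised using (mkℚᵘ; *≡*) renaming (_≃_ to _≃ᵘ_)
import Data.Rational.Unnormalised as ℚᵘ
import Data.Rational.Unnormalised.Properties as ℚᵘ
open import Function using (_∘_)
open import Relation.Binary.PropositionalEquality
open import Relation.Nullary using (yes; no)

open import Algebra.Properties.Semiring.Sum (CommutativeRing.semiring +-*-commutativeRing)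
  using (sum; sum-syntax; sum-cong-≗; ∑-distrib-+; *-distribˡ-sum; sum-init-last; sum-replicate-zero)

-- Offer a single price 1 bought with probability ρ = b / T.  The LP offers it in every period,
-- so OPT_LP = T ρ = b.  Let V t k be the expected revenue of always offering the price with t
-- periods and k units left.  A unit of inventory is worth at most its price (V t (k+1) ≤ 1 + V t k),
-- so V grows with t and no policy beats V.  Finally V satisfies the first-step recursion of
-- E[min(Bin(t, ρ), k)], hence equals it.

toℚᵘ-/ : ∀ m n → toℚᵘ ((+ m) / suc n) ≃ᵘ mkℚᵘ (+ m) n
toℚᵘ-/ m n = toℚᵘ-fromℚᵘ (mkℚᵘ (+ m) n)

module _ where
  open ℤ-Solver.+-*-Solver
  open ℚᵘ.≃-Reasoning

  ℕ→ℚ-+ : ∀ m n → ℕ→ℚ (m ℕ.+ n) ≡ ℕ→ℚ m + ℕ→ℚ n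
  ℕ→ℚ-+ m n = toℚᵘ-injective (begin
    toℚᵘ (ℕ→ℚ (m ℕ.+ n))                 ≈⟨ toℚᵘ-/ (m ℕ.+ n) 0 ⟩
    mkℚᵘ (+ (m ℕ.+ n)) 0                 ≈⟨ *≡* (cong (ℤ._* + 1) (ℤₚ.pos-+ m n)) ⟩
    mkℚᵘ (+ m ℤ.+ + n) 0                 ≈⟨ *≡* (solve 2 (λ x y → (x :+ y) :* con (+ 1)
                                              := (x :* con (+ 1) :+ y :* con (+ 1)) :* con (+ 1))
                                              refl (+ m) (+ n)) ⟩
    mkℚᵘ (+ m) 0 ℚᵘ.+ mkℚᵘ (+ n) 0       ≈⟨ ℚᵘ.+-cong (toℚᵘ-/ m 0) (toℚᵘ-/ n 0) ⟨
    toℚᵘ (ℕ→ℚ m) ℚᵘ.+ toℚᵘ (ℕ→ℚ n)       ≈⟨ toℚᵘ-homo-+ (ℕ→ℚ m) (ℕ→ℚ n) ⟨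
    toℚᵘ (ℕ→ℚ m + ℕ→ℚ n)                 ∎)

  ℕ→ℚ-*-/ : ∀ n m .{{_ : NonZero n}} → ℕ→ℚ n * ((+ m) / n) ≡ ℕ→ℚ m
  ℕ→ℚ-*-/ (suc n) m = toℚᵘ-injective (begin
    toℚᵘ (ℕ→ℚ (suc n) * ((+ m) / suc n))
      ≈⟨ toℚᵘ-homo-* (ℕ→ℚ (suc n)) ((+ m) / suc n) ⟩
    toℚᵘ (ℕ→ℚ (suc n)) ℚᵘ.* toℚᵘ ((+ m) / suc n)
      ≈⟨ ℚᵘ.*-cong (toℚᵘ-/ (suc n) 0) (toℚᵘ-/ m n) ⟩
    mkℚᵘ (+ suc n) 0 ℚᵘ.* mkℚᵘ (+ m) n
      ≈⟨ *≡* (trans (solve 2 (λ x y → (x :* y) :* con (+ 1) := y :* x) refl (+ suc n) (+ m))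
                    (cong (λ d → + m ℤ.* + suc d) (sym (ℕₚ.+-identityʳ n)))) ⟩
    mkℚᵘ (+ m) 0
      ≈⟨ toℚᵘ-/ m 0 ⟨
    toℚᵘ (ℕ→ℚ m)
      ∎)

  1/n*n≡1 : ∀ n .{{_ : NonZero n}} → ((+ 1) / n) * ℕ→ℚ n ≡ 1ℚ
  1/n*n≡1 (suc n) = toℚᵘ-injective (begin
    toℚᵘ (((+ 1) / suc n) * ℕ→ℚ (suc n))
      ≈⟨ toℚᵘ-homo-* ((+ 1) / suc n) (ℕ→ℚ (suc n)) ⟩
    toℚᵘ ((+ 1) / suc n) ℚᵘ.* toℚᵘ (ℕ→ℚ (suc n))
      ≈⟨ ℚᵘ.*-cong (toℚᵘ-/ 1 n) (toℚᵘ-/ (suc n) 0) ⟩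
    mkℚᵘ (+ 1) n ℚᵘ.* mkℚᵘ (+ suc n) 0
      ≈⟨ *≡* (trans (solve 1 (λ x → (con (+ 1) :* x) :* con (+ 1) := con (+ 1) :* x) refl (+ suc n))
                    (cong (λ d → + 1 ℤ.* + suc d) (sym (ℕₚ.*-identityʳ n)))) ⟩
    ℚᵘ.1ℚᵘ
      ∎)

/-≤-1 : ∀ {m n} .{{_ : NonZero n}} → m ℕ.≤ n → (+ m) / n ≤ 1ℚ
/-≤-1 {m} {suc n} m≤n = toℚᵘ-cancel-≤ (ℚᵘ.≤-respˡ-≃ (ℚᵘ.≃-sym (toℚᵘ-/ m n)) (ℚᵘ.*≤* m*1≤1*n))
  where
    m*1≤1*n : + m ℤ.* + 1 ℤ.≤ + 1 ℤ.* + suc n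
    m*1≤1*n = subst₂ ℤ._≤_ (sym (ℤₚ.*-identityʳ (+ m))) (sym (ℤₚ.*-identityˡ (+ suc n))) (ℤ.+≤+ m≤n)

convex-≤ : ∀ a c {x y z} .{{_ : NonNegative a}} .{{_ : NonNegative c}} →
           a + c ≡ 1ℚ → x ≤ z → y ≤ z → a * x + c * y ≤ z
convex-≤ a c {x} {y} {z} a+c≡1 x≤z y≤z = begin
  a * x + c * y   ≤⟨ +-mono-≤ (*-monoˡ-≤-nonNeg a x≤z) (*-monoˡ-≤-nonNeg c y≤z) ⟩
  a * z + c * z   ≡⟨ *-distribʳ-+ z a c ⟨
  (a + c) * z     ≡⟨ cong (_* z) a+c≡1 ⟩
  1ℚ * z          ≡⟨ *-identityˡ z ⟩
  z               ∎
  where open ≤-Reasoning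

sumFin≡sum : ∀ n (f : Fin n → ℚ) → sumFin n f ≡ sum f
sumFin≡sum zero    f = refl
sumFin≡sum (suc n) f = cong (_+_ (f Fin.zero)) (sumFin≡sum n (λ j → f (Fin.suc j)))

∑-drop-last-zero : ∀ n (h : ℕ → ℚ) → h n ≡ 0ℚ → ∑[ i < suc n ] h (toℕ i) ≡ ∑[ i < n ] h (toℕ i)
∑-drop-last-zero n h hn≡0 = begin
  ∑[ i < suc n ] h (toℕ i)                             ≡⟨ sum-init-last {n} (λ i → h (toℕ i)) ⟩
  ∑[ i < n ] h (toℕ (inject₁ i)) + h (toℕ (fromℕ n))   ≡⟨ cong₂ _+_ (sum-cong-≗ {n} (cong h ∘ toℕ-inject₁))
                                                                   (trans (cong h (toℕ-fromℕ n)) hn≡0) ⟩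
  ∑[ i < n ] h (toℕ i) + 0ℚ                            ≡⟨ +-identityʳ _ ⟩
  ∑[ i < n ] h (toℕ i)                                 ∎
  where open ≡-Reasoning

nC0≡1 : ∀ n → n C 0 ≡ 1
nC0≡1 zero    = refl
nC0≡1 (suc n) = refl

module Binomial (ρ : ℚ) where
  open ℚ-Solver.+-*-Solver

  σ : ℚ
  σ = 1ℚ - ρ

  ρ+σ≡1 : ρ + σ ≡ 1ℚ
  ρ+σ≡1 = solve 1 (λ r → r :+ (con 1ℚ :- r) := con 1ℚ) refl ρ

  binomialMass : ℕ → ℕ → ℚ
  binomialMass t i = ℕ→ℚ (t C i) * pow ρ i * pow σ (t ∸ i)

  expectation : ℕ → (ℕ → ℚ) → ℚ
  expectation t g = ∑[ i < suc t ] (binomialMass t (toℕ i) * g (toℕ i))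

  binomialMass-beyond : ∀ t → binomialMass t (suc t) ≡ 0ℚ
  binomialMass-beyond t rewrite k>n⇒nCk≡0 (ℕₚ.n<1+n t) =
    solve 2 (λ p q → con 0ℚ :* p :* q := con 0ℚ) refl (pow ρ (suc t)) (pow σ (t ∸ suc t))

  binomialMass-zero : ∀ t → binomialMass (suc t) 0 ≡ σ * binomialMass t 0
  binomialMass-zero t rewrite nC0≡1 t | nC0≡1 (suc t) =
    solve 2 (λ r p → con 1ℚ :* con 1ℚ :* ((con 1ℚ :- r) :* p) := (con 1ℚ :- r) :* (con 1ℚ :* con 1ℚ :* p))
      refl ρ (pow σ t)

  -- Truncated subtraction: for i ≥ t the exponents t ∸ i and t ∸ suc i are both 0,
  -- and the identity only holds because t C suc i vanishes.
  C-suc*pow-∸ : ∀ t i → ℕ→ℚ (t C suc i) * pow σ (t ∸ i) ≡ ℕ→ℚ (t C suc i) * (σ * pow σ (t ∸ suc i))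
  C-suc*pow-∸ t i with i ℕₚ.<? t
  ... | yes (s≤s i≤t′) = cong (λ e → ℕ→ℚ (t C suc i) * pow σ e) (ℕₚ.+-∸-assoc 1 i≤t′)
  ... | no i≮t rewrite k>n⇒nCk≡0 (s≤s (ℕₚ.≮⇒≥ i≮t)) =
    trans (*-zeroˡ (pow σ (t ∸ i))) (sym (*-zeroˡ (σ * pow σ (t ∸ suc i))))

  binomialMass-suc : ∀ t i → binomialMass (suc t) (suc i) ≡ ρ * binomialMass t i + σ * binomialMass t (suc i)
  binomialMass-suc t i = begin
    ℕ→ℚ (suc t C suc i) * (ρ * P) * S
      ≡⟨ cong (λ n → ℕ→ℚ n * (ρ * P) * S) (sym (nCk+nC[k+1]≡[n+1]C[k+1] t i)) ⟩
    ℕ→ℚ (t C i ℕ.+ t C suc i) * (ρ * P) * S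
      ≡⟨ cong (λ x → x * (ρ * P) * S) (ℕ→ℚ-+ (t C i) (t C suc i)) ⟩
    (a + c) * (ρ * P) * S
      ≡⟨ solve 5 (λ r a c P S → (a :+ c) :* (r :* P) :* S := r :* (a :* P :* S) :+ r :* P :* (c :* S))
           refl ρ a c P S ⟩
    ρ * (a * P * S) + ρ * P * (c * S)
      ≡⟨ cong (λ x → ρ * (a * P * S) + ρ * P * x) (C-suc*pow-∸ t i) ⟩
    ρ * (a * P * S) + ρ * P * (c * (σ * S′))
      ≡⟨ solve 7 (λ r s a c P S S′ → r :* (a :* P :* S) :+ r :* P :* (c :* (s :* S′))
                                   := r :* (a :* P :* S) :+ s :* (c :* (r :* P) :* S′))
           refl ρ σ a c P S S′ ⟩
    ρ * binomialMass t i + σ * binomialMass t (suc i)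
      ∎
    where
      open ≡-Reasoning
      a = ℕ→ℚ (t C i)
      c = ℕ→ℚ (t C suc i)
      P = pow ρ i
      S = pow σ (t ∸ i)
      S′ = pow σ (t ∸ suc i)

  expectation-cong : ∀ t {f g : ℕ → ℚ} → (∀ i → f i ≡ g i) → expectation t f ≡ expectation t g
  expectation-cong t f≗g = sum-cong-≗ {suc t} (λ i → cong (binomialMass t (toℕ i) *_) (f≗g (toℕ i)))

  expectation-+ : ∀ t (f g : ℕ → ℚ) → expectation t (λ i → f i + g i) ≡ expectation t f + expectation t g
  expectation-+ t f g = trans (sum-cong-≗ {suc t} (λ i → *-distribˡ-+ (mass i) (f (toℕ i)) (g (toℕ i))))
                              (∑-distrib-+ (λ i → mass i * f (toℕ i)) (λ i → mass i * g (toℕ i)))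
    where
      mass : Fin (suc t) → ℚ
      mass i = binomialMass t (toℕ i)

  expectation-suc : ∀ t g → expectation (suc t) g ≡ ρ * expectation t (g ∘ suc) + σ * expectation t g
  expectation-suc t g = begin
    expectation (suc t) g
      ≡⟨ cong₂ _+_ (cong (_* g 0) (binomialMass-zero t)) (sum-cong-≗ {suc t} firstStep) ⟩
    σ * m₀ * g 0 + ∑[ j < suc t ] (ρ * f j + σ * h j)
      ≡⟨ cong (_+_ (σ * m₀ * g 0)) (trans (∑-distrib-+ (λ j → ρ * f j) (λ j → σ * h j))
                                         (sym (cong₂ _+_ (*-distribˡ-sum ρ f) (*-distribˡ-sum σ h)))) ⟩
    σ * m₀ * g 0 + (ρ * Ef + σ * ∑h)
      ≡⟨ solve 6 (λ r s m g₀ x y → s :* m :* g₀ :+ (r :* x :+ s :* y) := r :* x :+ s :* (m :* g₀ :+ y))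
           refl ρ σ m₀ (g 0) Ef ∑h ⟩
    ρ * Ef + σ * (m₀ * g 0 + ∑h)
      ≡⟨ cong (λ x → ρ * Ef + σ * x) (∑-drop-last-zero (suc t) (λ i → binomialMass t i * g i) lastTerm) ⟩
    ρ * Ef + σ * expectation t g
      ∎
    where
      open ≡-Reasoning
      m₀ = binomialMass t 0
      Ef = expectation t (g ∘ suc)
      f h : Fin (suc t) → ℚ
      f j = binomialMass t (toℕ j) * g (suc (toℕ j))
      h j = binomialMass t (suc (toℕ j)) * g (suc (toℕ j))
      ∑h = ∑[ j < suc t ] h j
      firstStep : ∀ j → binomialMass (suc t) (suc (toℕ j)) * g (suc (toℕ j)) ≡ ρ * f j + σ * h j
      firstStep j = trans (cong (_* g (suc (toℕ j))) (binomialMass-suc t (toℕ j)))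
        (solve 5 (λ r s a b x → (r :* a :+ s :* b) :* x := r :* (a :* x) :+ s :* (b :* x))
          refl ρ σ (binomialMass t (toℕ j)) (binomialMass t (suc (toℕ j))) (g (suc (toℕ j))))
      lastTerm : binomialMass t (suc t) * g (suc t) ≡ 0ℚ
      lastTerm = trans (cong (_* g (suc t)) (binomialMass-beyond t)) (*-zeroˡ (g (suc t)))

  expectation-1 : ∀ t → expectation t (λ _ → 1ℚ) ≡ 1ℚ
  expectation-1 zero    = refl
  expectation-1 (suc t) = begin
    expectation (suc t) (λ _ → 1ℚ)
      ≡⟨ expectation-suc t (λ _ → 1ℚ) ⟩
    ρ * expectation t (λ _ → 1ℚ) + σ * expectation t (λ _ → 1ℚ)
      ≡⟨ cong₂ (λ x y → ρ * x + σ * y) (expectation-1 t) (expectation-1 t) ⟩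
    ρ * 1ℚ + σ * 1ℚ
      ≡⟨ cong₂ _+_ (*-identityʳ ρ) (*-identityʳ σ) ⟩
    ρ + σ
      ≡⟨ ρ+σ≡1 ⟩
    1ℚ
      ∎
    where open ≡-Reasoning

  expectedMin : ℕ → ℕ → ℚ
  expectedMin t k = expectation t (λ i → ℕ→ℚ (i ⊓ k))

  expectedMin-zero : ∀ t → expectedMin t 0 ≡ 0ℚ
  expectedMin-zero t = trans (expectation-cong t (λ i → cong ℕ→ℚ (ℕₚ.⊓-zeroʳ i)))
    (trans (sum-cong-≗ {suc t} (λ i → *-zeroʳ (binomialMass t (toℕ i)))) (sum-replicate-zero (suc t)))

  expectedMin-suc : ∀ t k → expectedMin (suc t) (suc k) ≡ ρ * (1ℚ + expectedMin t k) + σ * expectedMin t (suc k)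
  expectedMin-suc t k = trans (expectation-suc t (λ i → ℕ→ℚ (i ⊓ suc k)))
    (cong (λ x → ρ * x + σ * expectedMin t (suc k)) (begin
      expectation t (λ i → ℕ→ℚ (suc (i ⊓ k)))       ≡⟨ expectation-cong t (λ i → ℕ→ℚ-+ 1 (i ⊓ k)) ⟩
      expectation t (λ i → 1ℚ + ℕ→ℚ (i ⊓ k))        ≡⟨ expectation-+ t (λ _ → 1ℚ) (λ i → ℕ→ℚ (i ⊓ k)) ⟩
      expectation t (λ _ → 1ℚ) + expectedMin t k    ≡⟨ cong (_+ expectedMin t k) (expectation-1 t) ⟩
      1ℚ + expectedMin t k                          ∎))
    where open ≡-Reasoning

  binomExpMin≡expectedMin : ∀ t k → binomExpMin t ρ k ≡ expectedMin t k
  binomExpMin≡expectedMin t k = sumFin≡sum (suc t) (λ i → binomialMass t (toℕ i) * ℕ→ℚ (toℕ i ⊓ k))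

module SinglePrice (ρ : ℚ) where
  open Binomial ρ

  alwaysOfferValue : ℕ → ℕ → ℚ
  alwaysOfferValue zero    k       = 0ℚ
  alwaysOfferValue (suc t) zero    = 0ℚ
  alwaysOfferValue (suc t) (suc k) = ρ * (1ℚ + alwaysOfferValue t k) + σ * alwaysOfferValue t (suc k)

  alwaysOfferValue-zero : ∀ t → alwaysOfferValue t 0 ≡ 0ℚ
  alwaysOfferValue-zero zero    = refl
  alwaysOfferValue-zero (suc t) = refl

  alwaysOfferValue≡expectedMin : ∀ t k → alwaysOfferValue t k ≡ expectedMin t k
  alwaysOfferValue≡expectedMin zero    k       = refl
  alwaysOfferValue≡expectedMin (suc t) zero    = sym (expectedMin-zero (suc t))
  alwaysOfferValue≡expectedMin (suc t) (suc k) = trans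
    (cong₂ (λ x y → ρ * (1ℚ + x) + σ * y) (alwaysOfferValue≡expectedMin t k) (alwaysOfferValue≡expectedMin t (suc k)))
    (sym (expectedMin-suc t k))

  module _ (0<ρ : 0ℚ < ρ) (ρ≤1 : ρ ≤ 1ℚ) where
    open ℚ-Solver.+-*-Solver

    singlePrice : Instance
    singlePrice = record
      { m = 1 ; m-pos = s≤s z≤n ; price = λ _ → 1ℚ ; prob = λ _ → ρ
      ; price-pos = λ _ → positive⁻¹ 1ℚ ; prob-pos = λ _ → 0<ρ ; prob-le1 = λ _ → ρ≤1 }

    instance
      ρ-nonNeg : NonNegative ρ
      ρ-nonNeg = nonNegative (<⇒≤ 0<ρ)

      σ-nonNeg : NonNegative σ
      σ-nonNeg = nonNegative (subst (_≤ σ) (+-inverseʳ ρ) (+-monoˡ-≤ (- ρ) ρ≤1))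

    alwaysOfferValue-suc-inventory : ∀ t k → alwaysOfferValue t (suc k) ≤ 1ℚ + alwaysOfferValue t k
    alwaysOfferValue-suc-inventory zero    k       = nonNegative⁻¹ 1ℚ
    alwaysOfferValue-suc-inventory (suc t) zero    = convex-≤ ρ σ ρ+σ≡1 1+V₀≤1+0
      (≤-trans (alwaysOfferValue-suc-inventory t 0) 1+V₀≤1+0)
      where
        1+V₀≤1+0 : 1ℚ + alwaysOfferValue t 0 ≤ 1ℚ + 0ℚ
        1+V₀≤1+0 = ≤-reflexive (cong (_+_ 1ℚ) (alwaysOfferValue-zero t))
    alwaysOfferValue-suc-inventory (suc t) (suc k) = begin
      ρ * (1ℚ + V t (suc k)) + σ * V t (suc (suc k))
        ≤⟨ +-mono-≤ (*-monoˡ-≤-nonNeg ρ (+-monoʳ-≤ 1ℚ (alwaysOfferValue-suc-inventory t k)))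
                    (*-monoˡ-≤-nonNeg σ (alwaysOfferValue-suc-inventory t (suc k))) ⟩
      ρ * (1ℚ + (1ℚ + V t k)) + σ * (1ℚ + V t (suc k))
        ≡⟨ solve 3 (λ r x y → r :* (con 1ℚ :+ (con 1ℚ :+ x)) :+ (con 1ℚ :- r) :* (con 1ℚ :+ y)
                              := con 1ℚ :+ (r :* (con 1ℚ :+ x) :+ (con 1ℚ :- r) :* y))
             refl ρ (V t k) (V t (suc k)) ⟩
      1ℚ + V (suc t) (suc k) ∎
      where
        open ≤-Reasoning
        V = alwaysOfferValue

    alwaysOfferValue-mono-time : ∀ t k → alwaysOfferValue t k ≤ alwaysOfferValue (suc t) k
    alwaysOfferValue-mono-time t zero    = ≤-reflexive (alwaysOfferValue-zero t)
    alwaysOfferValue-mono-time t (suc k) = begin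
      V t (suc k)
        ≡⟨ solve 2 (λ r x → x := r :* x :+ (con 1ℚ :- r) :* x) refl ρ (V t (suc k)) ⟩
      ρ * V t (suc k) + σ * V t (suc k)
        ≤⟨ +-monoˡ-≤ (σ * V t (suc k)) (*-monoˡ-≤-nonNeg ρ (alwaysOfferValue-suc-inventory t k)) ⟩
      ρ * (1ℚ + V t k) + σ * V t (suc k)
        ∎
      where
        open ≤-Reasoning
        V = alwaysOfferValue

    revenueFrom-≤-alwaysOfferValue : ∀ (π : Policy singlePrice) t k h →
                                     revenueFrom singlePrice π t k h ≤ alwaysOfferValue t k
    revenueFrom-≤-alwaysOfferValue π zero    k       h = ≤-refl
    revenueFrom-≤-alwaysOfferValue π (suc t) zero    h = ≤-refl
    revenueFrom-≤-alwaysOfferValue π (suc t) (suc k) h = begin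
      a₀ * R₀ + (a₁ * offer + 0ℚ)  ≡⟨ cong (_+_ (a₀ * R₀)) (+-identityʳ (a₁ * offer)) ⟩
      a₀ * R₀ + a₁ * offer         ≤⟨ convex-≤ a₀ a₁ {{nonNegative (act-nonneg π h nothing)}}
                                               {{nonNegative (act-nonneg π h (just Fin.zero))}}
                                      (trans (cong (_+_ a₀) (sym (+-identityʳ a₁))) (act-sum π h))
                                      (≤-trans (bound t (suc k)) (alwaysOfferValue-mono-time t (suc k)))
                                      (+-mono-≤ (*-monoˡ-≤-nonNeg ρ (+-monoʳ-≤ 1ℚ (bound t k)))
                                                (*-monoˡ-≤-nonNeg σ (bound t (suc k)))) ⟩
      alwaysOfferValue (suc t) (suc k) ∎
      where
        open ≤-Reasoning
        a₀ = act π h nothing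
        a₁ = act π h (just Fin.zero)
        R₀ = revenueFrom singlePrice π t (suc k) ((nothing , false) ∷ h)
        offer = ρ * (1ℚ + revenueFrom singlePrice π t k ((just Fin.zero , true) ∷ h))
              + σ * revenueFrom singlePrice π t (suc k) ((just Fin.zero , false) ∷ h)
        bound : ∀ t k {h} → revenueFrom singlePrice π t k h ≤ alwaysOfferValue t k
        bound t k = revenueFrom-≤-alwaysOfferValue π t k _

    LPObjective≡consumption : ∀ T x → LPObjective singlePrice T x ≡ ℕ→ℚ T * sumFin 1 (λ j → ρ * x j)
    LPObjective≡consumption T x = cong (λ p → ℕ→ℚ T * (p * x Fin.zero + 0ℚ)) (*-identityˡ ρ)

    singlePrice-isOPT : ∀ T b → ℕ→ℚ T * ρ ≡ ℕ→ℚ b → IsOPT-LP singlePrice T b (ℕ→ℚ b)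
    singlePrice-isOPT T b Tρ≡b =
      ( (λ _ → 1ℚ)
      , ((λ _ → nonNegative⁻¹ 1ℚ) , ≤-reflexive (+-identityʳ 1ℚ) , ≤-reflexive fullConsumption)
      , trans (LPObjective≡consumption T (λ _ → 1ℚ)) fullConsumption )
      , λ x (_ , _ , consumption≤b) → subst (_≤ ℕ→ℚ b) (sym (LPObjective≡consumption T x)) consumption≤b
      where
        fullConsumption : ℕ→ℚ T * (ρ * 1ℚ + 0ℚ) ≡ ℕ→ℚ b
        fullConsumption = trans (cong (ℕ→ℚ T *_) (trans (+-identityʳ (ρ * 1ℚ)) (*-identityʳ ρ))) Tρ≡b

proposition3 : ∀ (T b : ℕ) .{{_ : NonZero T}} .{{_ : NonZero b}} → b ℕ.≤ T →
    Σ Instance (λ I → Σ ℚ (λ v → IsOPT-LP I T b v ×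
    (∀ (π : Policy I) → revenue I π T b ≤ (binomExpMin T ((+ b) / T) b * ((+ 1) / b)) * v)))
proposition3 T b b≤T =
  singlePrice 0<ρ ρ≤1 , ℕ→ℚ b , singlePrice-isOPT 0<ρ ρ≤1 T b (ℕ→ℚ-*-/ T b) , revenue-bound
  where
    ρ = (+ b) / T
    0<ρ : 0ℚ < ρ
    0<ρ = positive⁻¹ ρ {{normalize-pos b T}}
    ρ≤1 : ρ ≤ 1ℚ
    ρ≤1 = /-≤-1 b≤T
    open SinglePrice ρ
    open Binomial ρ using (expectedMin; binomExpMin≡expectedMin)
    revenue-bound : ∀ π → revenue (singlePrice 0<ρ ρ≤1) π T b ≤ (binomExpMin T ρ b * ((+ 1) / b)) * ℕ→ℚ b
    revenue-bound π = begin
      revenue (singlePrice 0<ρ ρ≤1) π T b       ≤⟨ revenueFrom-≤-alwaysOfferValue 0<ρ ρ≤1 π T b [] ⟩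
      alwaysOfferValue T b                      ≡⟨ alwaysOfferValue≡expectedMin T b ⟩
      expectedMin T b                           ≡⟨ binomExpMin≡expectedMin T b ⟨
      binomExpMin T ρ b                         ≡⟨ *-identityʳ (binomExpMin T ρ b) ⟨
      binomExpMin T ρ b * 1ℚ                    ≡⟨ cong (binomExpMin T ρ b *_) (1/n*n≡1 b) ⟨
      binomExpMin T ρ b * ((+ 1) / b * ℕ→ℚ b)   ≡⟨ *-assoc (binomExpMin T ρ b) ((+ 1) / b) (ℕ→ℚ b) ⟨
      (binomExpMin T ρ b * ((+ 1) / b)) * ℕ→ℚ b ∎
      where open ≤-Reasoning
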